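{- Let $\lambda=(\mu_1,\mu_2)$ be a neighborly partition. Then $\operatorname{signature}(G_\lambda)=0$ if and only if the multiset $SIG(G_\lambda)$ contains an element $x\equiv 0\pmod 3$. Otherwise $$ \operatorname{signature}(G_\lambda)=(-1)^{t+s}, $$ where $t$ is the number of elements (counted with multiplicity) $x\in SIG(G_\lambda)$ with $x\equiv 1\pmod 3$, and $s$ is the number of parts of $\mu_2$.
   Context: Partitions are written with parts in increasing order. A partition $\lambda$ is neighborly if every value occurs as a part at most twice and for every part $\lambda_i$ there is a part $\lambda_j$ with $j\ne i$ and $|\lambda_i-\lambda_j|\le 1$. Write $\lambda=(\mu_1,\mu_2)$ where $\mu_1$ is the set of distinct part values and $\mu_2\subseteq\mu_1$ the set of values occurring twice. The graph $G_\lambda$ has one vertex $v$ for each $v\in\mu_1$ and one additional vertex $v'$ for each $v\in\mu_2$; its edges are the backbone edges $\{v,v+1\}$ whenever $v,v+1\in\mu_1$, and the hanging edges $\{v,v'\}$ for $v\in\mu_2$. For a finite graph $G$, a vertex spanning forest is a set $H$ of edges such that every vertex is incident to some edge of $H$, and $\operatorname{signature}(G)=\sum_H(-1)^{|H|}$ over all vertex spanning forests $H$. Signature multiset: each connected component $c$ of $G_\lambda$ has backbone vertices forming a maximal run $\{k,k+1,\dots,n\}$ of consecutive integers in $\mu_1$; let $a_1<\dots<a_s$ be the elements of $\mu_2$ in this run. If $s\ge1$, $SIG(c)$ is the multiset $\{a_1-k+1,\ a_2-a_1+2,\ \dots,\ a_s-a_{s-1}+2,\ n-a_s+1\}$; if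 $s=0$ (then $n>k$), $SIG(c)=\{n-k\}$. $SIG(G_\lambda)$ is the multiset union of $SIG(c)$ over all connected components $c$. -}

module Defs where

open import Data.Bool using (Bool; true; false; _∧_; _∨_; not; if_then_else_; T)
open import Data.Nat.DivMod
open import Data.Nat using (ℕ; zero; suc; _+_; _∸_; _≤_; _<_; _≡ᵇ_; _≤ᵇ_)
open import Data.Nat.Properties using (_≟_)
open import Data.List using (List; []; _∷_; _++_; map; filter; length; foldr; concatMap; lookup)
open import Data.Bool.ListAction using (any; all)
open import Data.List.Relation.Unary.All using (All)
open import Data.List.Relation.Unary.Linked using (Linked)
open import Data.Fin using (Fin)
open import Data.Integer as ℤ using (ℤ; +_; -[1+_])
open import Data.Product using (∃; _×_)
open import Relation.Binary.PropositionalEquality using (_≡_; _≢_)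

occ : ℕ → List ℕ → ℕ
occ v xs = length (filter (λ x → v ≟ x) xs)

near : ℕ → ℕ → Set
near x y = x ≤ suc y × y ≤ suc x

IsPartition : List ℕ → Set
IsPartition λs = All (λ x → 1 ≤ x) λs × Linked _≤_ λs

Neighborly : List ℕ → Set
Neighborly λs =
  IsPartition λs
  × (∀ (v : ℕ) → occ v λs ≤ 2)
  × (∀ (i : Fin (length λs)) →
       ∃ λ (j : Fin (length λs)) → j ≢ i × near (lookup λs i) (lookup λs j))

memᵇ : ℕ → List ℕ → Bool
memᵇ v xs = any (λ x → v ≡ᵇ x) xs

dedup : List ℕ → List ℕ
dedup [] = []
dedup (x ∷ xs) = if memᵇ x xs then dedup xs else x ∷ dedup xs

μ₁ : List ℕ → List ℕ
μ₁ λs = dedup λs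

μ₂ : List ℕ → List ℕ
μ₂ λs = filter (λ v → 2 Data.Nat.≤? occ v λs) (μ₁ λs)

-- vertices of G_λ: v for v ∈ μ₁, and v' for v ∈ μ₂
data Vtx : Set where
  base  : ℕ → Vtx
  prime : ℕ → Vtx

_≡ᵛ_ : Vtx → Vtx → Bool
base x  ≡ᵛ base y  = x ≡ᵇ y
prime x ≡ᵛ prime y = x ≡ᵇ y
_       ≡ᵛ _       = false

record Edge : Set where
  constructor _—_
  field
    end₁ end₂ : Vtx

record Graph : Set where
  constructor graph
  field
    vertices : List Vtx
    edges    : List Edge
open Graph public

Gλ : List ℕ → Graph
Gλ λs = graph (map base m1 ++ map prime m2) (backbone ++ hanging)
  where
  m1 = μ₁ λs
  m2 = μ₂ λs
  backbone = map (λ v → base v — base (suc v)) (filter (λ v → Data.Bool.T? (memᵇ (suc v) m1)) m1)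
  hanging  = map (λ v → base v — prime v) m2

-- all sub(multi)sets of a list = all subsets of the edge set
subsets : {A : Set} → List A → List (List A)
subsets [] = [] ∷ []
subsets (x ∷ xs) = subsets xs ++ map (x ∷_) (subsets xs)

adjᵇ : List Edge → Vtx → Vtx → Bool
adjᵇ H u v = any (λ e → ((Edge.end₁ e ≡ᵛ u) ∧ (Edge.end₂ e ≡ᵛ v))
                      ∨ ((Edge.end₁ e ≡ᵛ v) ∧ (Edge.end₂ e ≡ᵛ u))) H

incidentᵇ : List Edge → Vtx → Bool
incidentᵇ H v = any (λ e → (Edge.end₁ e ≡ᵛ v) ∨ (Edge.end₂ e ≡ᵛ v)) H

seqs : ℕ → List Vtx → List (List Vtx)
seqs zero vs = [] ∷ []
seqs (suc k) vs = concatMap (λ v → map (v ∷_) (seqs k vs)) vs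

distinctᵇ : List Vtx → Bool
distinctᵇ [] = true
distinctᵇ (x ∷ xs) = not (any (x ≡ᵛ_) xs) ∧ distinctᵇ xs

pathᵇ : List Edge → List Vtx → Bool
pathᵇ H [] = true
pathᵇ H (x ∷ []) = true
pathᵇ H (x ∷ y ∷ xs) = adjᵇ H x y ∧ pathᵇ H (y ∷ xs)

lastOr : Vtx → List Vtx → Vtx
lastOr d [] = d
lastOr d (x ∷ xs) = lastOr x xs

cycleᵇ : List Edge → List Vtx → Bool
cycleᵇ H [] = false
cycleᵇ H (x ∷ xs) =
  (3 Data.Nat.≤ᵇ length (x ∷ xs)) ∧ distinctᵇ (x ∷ xs)
  ∧ pathᵇ H (x ∷ xs) ∧ adjᵇ H (lastOr x xs) x

upTo : ℕ → List ℕ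
upTo zero = []
upTo (suc n) = upTo n ++ (n ∷ [])

-- H contains a cycle (a cycle uses distinct vertices of G, so has
-- length at most the number of vertices of G)
hasCycleᵇ : Graph → List Edge → Bool
hasCycleᵇ G H =
  any (λ k → any (cycleᵇ H) (seqs k (vertices G))) (upTo (suc (length (vertices G))))

isVSFᵇ : Graph → List Edge → Bool
isVSFᵇ G H = all (incidentᵇ H) (vertices G) ∧ not (hasCycleᵇ G H)

sgn : ℕ → ℤ
sgn n = (ℤ.- (+ 1)) ℤ.^ n

signature : Graph → ℤ
signature G =
  foldr ℤ._+_ (+ 0)
    (map (λ H → if isVSFᵇ G H then sgn (length H) else + 0) (subsets (edges G)))

-- split a strictly increasing list into maximal runs of consecutive integers
addTo : ℕ → List (List ℕ) → List (List ℕ)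
addTo x ((y ∷ r) ∷ rs) =
  if y ≡ᵇ suc x then (x ∷ y ∷ r) ∷ rs else (x ∷ []) ∷ (y ∷ r) ∷ rs
addTo x rs = (x ∷ []) ∷ rs

runs : List ℕ → List (List ℕ)
runs = foldr addTo []

-- a_{i+1} - a_i + 2 , …, n - a_s + 1
gaps : ℕ → List ℕ → ℕ → List ℕ
gaps prev [] n = (n ∸ prev + 1) ∷ []
gaps prev (b ∷ bs) n = (b ∸ prev + 2) ∷ gaps b bs n

-- SIG of the component with backbone {k,…,n} and μ₂-elements as
sigRun : ℕ → ℕ → List ℕ → List ℕ
sigRun k n [] = (n ∸ k) ∷ []
sigRun k n (a ∷ as) = (a ∸ k + 1) ∷ gaps a as n

SIGcomp : List ℕ → List ℕ → List ℕ
SIGcomp m2 [] = []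
SIGcomp m2 (k ∷ r) = sigRun k (lastN k r) (filter (λ v → Data.Bool.T? (memᵇ v m2)) (k ∷ r))
  where
  lastN : ℕ → List ℕ → ℕ
  lastN d [] = d
  lastN d (x ∷ xs) = lastN x xs

SIG : List ℕ → List ℕ
SIG λs = concatMap (SIGcomp (μ₂ λs)) (runs (μ₁ λs))

count≡1mod3 : List ℕ → ℕ
count≡1mod3 xs = length (filter (λ x → Data.Nat.DivMod._%_ x 3 ≟ 1) xs)

-- Give v the height 2v and v′ the height 2v + 1. Every edge of G_λ climbs, and every
-- vertex has at most one lower neighbour, so the highest vertex of a cycle could not have
-- two distinct neighbours on it: G_λ is a forest, and its signature is the alternating
-- count Σ (-1)^|H| over the edge sets H covering every vertex. Sweeping the values of μ₁
-- upwards, this count obeys a transfer recursion whose state is whether the current base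
-- vertex is already covered. Along a run of consecutive values the recursion is solved
-- by χ, the signature of a path, which is 0, -1 or 1 according to its number of edges
-- mod 3: each run contributes the product of χ over its part of SIG(G_λ), and each
-- element of μ₂ a forced hanging edge, hence a factor -1.

module Submission where

open import Defs
open import Data.Bool using (Bool; true; false; T; T?; _∧_; _∨_; not; if_then_else_)
open import Data.Bool.ListAction using (any; all)
open import Data.Bool.Properties using (T-≡; T-∧; T-∨; ∧-identityʳ; ∨-identityʳ; ∨-zeroʳ)
open import Data.Empty using (⊥-elim)
open import Data.Integer as ℤ using (ℤ; +_; -_; _-_)
import Data.Integer.Properties as ℤP
open import Data.Integer.Tactic.RingSolver using (solve-∀)
open import Data.List using (List; []; _∷_; _++_; length; map; filter; foldr; concat; concatMap)
open import Data.List.Membership.Propositional using (_∈_)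
open import Data.List.Membership.Propositional.Properties using (∈-filter⁺; ∈-filter⁻; ∈-++⁺ʳ)
open import Data.List.Properties
  using (map-++; map-∘; map-cong; map-cong-local; filter-all; filter-reject; filter-none; filter-++; length-++; ∷-injectiveˡ)
open import Data.List.Relation.Binary.Permutation.Propositional as ↭ using (_↭_; ↭-sym; module PermutationReasoning)
open import Data.List.Relation.Binary.Permutation.Propositional.Properties
  using (filter-↭; ¬x∷xs↭[]; shifts; ++⁺ˡ) renaming (++-assoc to ↭-++-assoc)
open import Data.List.Relation.Unary.All as All using (All; []; _∷_; lookupAny)
open import Data.List.Relation.Unary.All.Properties using (++⁺; map⁺; filter⁺)
open import Data.List.Relation.Unary.AllPairs using (AllPairs; []; _∷_)
open import Data.List.Relation.Unary.Any as Any using (Any; here; there; satisfied)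
open import Data.List.Relation.Unary.Any.Properties using (any⁺; any⁻)
open import Data.List.Relation.Unary.Linked using (Linked; []; [-]; _∷_)
open import Data.List.Relation.Unary.Linked.Properties using (Linked⇒AllPairs)
open import Data.List.Relation.Unary.Unique.Propositional using (Unique)
open import Data.Nat using (ℕ; zero; suc; _+_; _∸_; _%_; _<_; _≤_; _≤?_; _≡ᵇ_; s≤s)
open import Data.Nat.DivMod using ([m+n]%n≡m%n)
open import Data.Nat.Properties
  using (_≟_; ≡ᵇ⇒≡; ≡⇒≡ᵇ; 0≢1+n; +-comm; +-suc; +-mono-<; n∸n≡0; n<1+n; n≤1+n; ≤-refl; ≤-trans; ≤-pred; <⇒≤;
         <-irrefl; <-asym; <-trans; <-≤-trans; ≤-<-trans; ≤∧≢⇒<; <⇒≢; >⇒≢; <-cmp)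
open import Data.Product using (_×_; _,_; proj₁; proj₂; ∃)
open import Data.Sum as Sum using (_⊎_; inj₁; inj₂; [_,_]′)
open import Function.Base using (_∘_)
open import Function.Bundles using (_⇔_; Equivalence; mk⇔)
open import Relation.Binary using (tri<; tri≈; tri>)
open import Relation.Binary.PropositionalEquality
  using (_≡_; _≢_; refl; sym; trans; cong; cong₂; ≢-sym; subst; subst₂; module ≡-Reasoning)
open import Relation.Nullary using (¬_; ¬?; Dec; yes; no)
open import Relation.Unary using (Decidable)

≡ᵛ⇒≡ : ∀ {u v} → T (u ≡ᵛ v) → u ≡ v
≡ᵛ⇒≡ {base x}  {base y}  p = cong base  (≡ᵇ⇒≡ x y p)
≡ᵛ⇒≡ {prime x} {prime y} p = cong prime (≡ᵇ⇒≡ x y p)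

≡ᵛ-refl : ∀ v → T (v ≡ᵛ v)
≡ᵛ-refl (base x)  = ≡⇒≡ᵇ x x refl
≡ᵛ-refl (prime x) = ≡⇒≡ᵇ x x refl

T-not⇒¬T : ∀ {b} → T (not b) → ¬ T b
T-not⇒¬T {false} _ ()

¬T⇒≡false : ∀ {b} → ¬ T b → b ≡ false
¬T⇒≡false {true}  ¬t = ⊥-elim (¬t _)
¬T⇒≡false {false} _  = refl

∧-split : ∀ {a b} → T (a ∧ b) → T a × T b
∧-split = Equivalence.to T-∧

∨-split : ∀ {a b} → T (a ∨ b) → T a ⊎ T b
∨-split = Equivalence.to T-∨

distinctᵇ⇒Unique : ∀ xs → T (distinctᵇ xs) → Unique xs
distinctᵇ⇒Unique []       _ = []
distinctᵇ⇒Unique (x ∷ xs) d =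
  let fresh , rest = ∧-split {not (any (x ≡ᵛ_) xs)} d
  in  All.tabulate (λ x∈xs → λ { refl → T-not⇒¬T fresh (any⁺ (x ≡ᵛ_) (Any.map (λ { refl → ≡ᵛ-refl x }) x∈xs)) })
        ∷ distinctᵇ⇒Unique xs rest

memᵇ⇒∈ : ∀ {x} xs → T (memᵇ x xs) → x ∈ xs
memᵇ⇒∈ {x} xs m = Any.map (≡ᵇ⇒≡ x _) (any⁻ _ xs m)

∈⇒memᵇ : ∀ {x xs} → x ∈ xs → T (memᵇ x xs)
∈⇒memᵇ {x} x∈xs = any⁺ _ (Any.map (λ { refl → ≡⇒≡ᵇ x x refl }) x∈xs)

filter-cong-local : ∀ {A : Set} {P Q : A → Set} (P? : Decidable P) (Q? : Decidable Q) {xs}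
                  → All (λ x → P x ⇔ Q x) xs → filter P? xs ≡ filter Q? xs
filter-cong-local P? Q? []                   = refl
filter-cong-local P? Q? {x ∷ _} (Px⇔Qx ∷ rest) with P? x | Q? x
... | yes _  | yes _  = cong (x ∷_) (filter-cong-local P? Q? rest)
... | no _   | no _   = filter-cong-local P? Q? rest
... | yes px | no ¬qx = ⊥-elim (¬qx (Equivalence.to Px⇔Qx px))
... | no ¬px | yes qx = ⊥-elim (¬px (Equivalence.from Px⇔Qx qx))

memᵇ-∷-≢ : ∀ {x y} ys → x ≢ y → T (memᵇ x (y ∷ ys)) ⇔ T (memᵇ x ys)
memᵇ-∷-≢ {x} {y} ys x≢y = mk⇔ drop (λ m → ∈⇒memᵇ {x} (there (memᵇ⇒∈ ys m)))
  where
  drop : T (memᵇ x (y ∷ ys)) → T (memᵇ x ys)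
  drop m with memᵇ⇒∈ {x} (y ∷ ys) m
  ... | here x≡y  = ⊥-elim (x≢y x≡y)
  ... | there x∈ys = ∈⇒memᵇ {x} x∈ys

memᵇ-head : ∀ x xs → memᵇ x (x ∷ xs) ≡ true
memᵇ-head x xs = Equivalence.to T-≡ (∈⇒memᵇ {x} {x ∷ xs} (here refl))

-- G_λ is a forest

data _↗_ : Vtx → Vtx → Set where
  ↗base  : ∀ {v} → base v ↗ base (suc v)
  ↗prime : ∀ {v} → base v ↗ prime v

_~_ : Vtx → Vtx → Set
u ~ v = u ↗ v ⊎ v ↗ u

data StepEdge : Edge → Set where
  step : ∀ {u v} → u ↗ v → StepEdge (u — v)

height : Vtx → ℕ
height (base v)  = v + v
height (prime v) = suc (v + v)

↗-height : ∀ {u v} → u ↗ v → height u < height v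
↗-height {base v} ↗base  = +-mono-< (n<1+n v) (n<1+n v)
↗-height          ↗prime = n<1+n _

↗-unique : ∀ {u v w} → u ↗ w → v ↗ w → u ≡ v
↗-unique ↗base  ↗base  = refl
↗-unique ↗prime ↗prime = refl

~-height≢ : ∀ {u v} → u ~ v → height u ≢ height v
~-height≢ (inj₁ u↗v) eq = <-irrefl eq (↗-height u↗v)
~-height≢ (inj₂ v↗u) eq = <-irrefl (sym eq) (↗-height v↗u)

~-sym : ∀ {u v} → u ~ v → v ~ u
~-sym = Sum.swap

~-upward : ∀ {u v} → u ~ v → height u < height v → u ↗ v
~-upward (inj₁ u↗v) _  = u↗v
~-upward (inj₂ v↗u) lt = ⊥-elim (<-asym lt (↗-height v↗u))

no-peak : ∀ {a b c} → a ~ b → c ~ b → height a < height b → height c < height b → a ≡ c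
no-peak a~b c~b a<b c<b = ↗-unique (~-upward a~b a<b) (~-upward c~b c<b)

-- NBWalk a b y z: non-backtracking walks with first step a ~ b and last step y ~ z.
data NBWalk : Vtx → Vtx → Vtx → Vtx → Set where
  edge   : ∀ {a b} → a ~ b → NBWalk a b a b
  extend : ∀ {a b c y z} → a ~ b → a ≢ c → NBWalk b c y z → NBWalk a b y z

firstStep : ∀ {a b y z} → NBWalk a b y z → a ~ b
firstStep (edge a~b)       = a~b
firstStep (extend a~b _ _) = a~b

lastStep : ∀ {a b y z} → NBWalk a b y z → y ~ z
lastStep (edge a~b)     = a~b
lastStep (extend _ _ w) = lastStep w

ascending : ∀ {a b y z} → NBWalk a b y z → height a < height b → height a < height z
ascending (edge _) a<b = a<b
ascending (extend {b = b} {c} a~b a≢c w) a<b with <-cmp (height b) (height c)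
... | tri< b<c _ _ = <-trans a<b (ascending w b<c)
... | tri≈ _ b≡c _ = ⊥-elim (~-height≢ (firstStep w) b≡c)
... | tri> _ _ c<b = ⊥-elim (a≢c (no-peak a~b (~-sym (firstStep w)) a<b c<b))

descending : ∀ {a b y z} → NBWalk a b y z → height z < height y
           → height b < height a × height z < height a
descending (edge _) z<y = z<y , z<y
descending (extend {a = a} {b} a~b a≢c w) z<y with descending w z<y
... | c<b , z<b with <-cmp (height a) (height b)
...   | tri< a<b _ _ = ⊥-elim (a≢c (no-peak a~b (~-sym (firstStep w)) a<b c<b))
...   | tri≈ _ a≡b _ = ⊥-elim (~-height≢ a~b a≡b)
...   | tri> _ _ b<a = b<a , <-trans z<b b<a

closed-NBWalk-backtracks : ∀ {x x₁ y} → NBWalk x x₁ y x → x₁ ≡ y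
closed-NBWalk-backtracks {x} {x₁} {y} w with <-cmp (height x) (height x₁)
... | tri< x<x₁ _ _ = ⊥-elim (<-irrefl refl (ascending w x<x₁))
... | tri≈ _ x≡x₁ _ = ⊥-elim (~-height≢ (firstStep w) x≡x₁)
... | tri> _ _ x₁<x with <-cmp (height y) (height x)
...   | tri< y<x _ _ = no-peak (~-sym (firstStep w)) (lastStep w) x₁<x y<x
...   | tri≈ _ y≡x _ = ⊥-elim (~-height≢ (lastStep w) y≡x)
...   | tri> _ _ x<y = ⊥-elim (<-irrefl refl (proj₂ (descending w x<y)))

lastOr-∈ : ∀ x xs → lastOr x xs ∈ x ∷ xs
lastOr-∈ x []       = here refl
lastOr-∈ x (y ∷ ys) = there (lastOr-∈ y ys)

path⇒NBWalk : ∀ {x y z} zs → Linked _~_ (y ∷ z ∷ zs) → Unique (y ∷ z ∷ zs)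
            → lastOr z zs ~ x → All (_≢ x) (y ∷ z ∷ zs) → NBWalk y z (lastOr z zs) x
path⇒NBWalk []        (y~z ∷ _) _ z~x (y≢x ∷ _) = extend y~z y≢x (edge z~x)
path⇒NBWalk (_ ∷ zs) (y~z ∷ p) ((_ ∷ y≢z′ ∷ _) ∷ u) z~x (_ ∷ ≢x) =
  extend y~z y≢z′ (path⇒NBWalk zs p u z~x ≢x)

no-cycle : ∀ x x₁ x₂ rest → Linked _~_ (x ∷ x₁ ∷ x₂ ∷ rest) → Unique (x ∷ x₁ ∷ x₂ ∷ rest)
         → ¬ (lastOr x₂ rest ~ x)
no-cycle x x₁ x₂ rest (x~x₁ ∷ p) (x≢@(_ ∷ x≢x₂ ∷ _) ∷ u@(x₁≢ ∷ _)) closing =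
  All.lookup x₁≢ (lastOr-∈ x₂ rest) (closed-NBWalk-backtracks walk)
  where
  walk : NBWalk x x₁ (lastOr x₂ rest) x
  walk = extend x~x₁ x≢x₂ (path⇒NBWalk rest p u closing (All.map ≢-sym x≢))

module _ {H : List Edge} (steps : All StepEdge H) where

  adjᵇ⇒~ : ∀ {u v} → T (adjᵇ H u v) → u ~ v
  adjᵇ⇒~ h with lookupAny steps (any⁻ _ H h)
  ... | step p , joined with ∨-split joined
  ...   | inj₁ fwd = let e₁ , e₂ = ∧-split fwd in subst₂ _~_ (≡ᵛ⇒≡ e₁) (≡ᵛ⇒≡ e₂) (inj₁ p)
  ...   | inj₂ bwd = let e₁ , e₂ = ∧-split bwd in subst₂ _~_ (≡ᵛ⇒≡ e₂) (≡ᵛ⇒≡ e₁) (inj₂ p)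

  pathᵇ⇒Linked : ∀ xs → T (pathᵇ H xs) → Linked _~_ xs
  pathᵇ⇒Linked []           _ = []
  pathᵇ⇒Linked (_ ∷ [])     _ = [-]
  pathᵇ⇒Linked (_ ∷ y ∷ xs) p =
    let adj , rest = ∧-split {adjᵇ H _ y} p in adjᵇ⇒~ adj ∷ pathᵇ⇒Linked (y ∷ xs) rest

  cycleᵇ-impossible : ∀ xs → ¬ T (cycleᵇ H xs)
  cycleᵇ-impossible (x ∷ x₁ ∷ x₂ ∷ rest) c =
    let distinct , c′      = ∧-split {distinctᵇ (x ∷ x₁ ∷ x₂ ∷ rest)} c
        path     , closing = ∧-split {pathᵇ H (x ∷ x₁ ∷ x₂ ∷ rest)} c′
    in  no-cycle x x₁ x₂ rest (pathᵇ⇒Linked _ path) (distinctᵇ⇒Unique _ distinct) (adjᵇ⇒~ closing)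

  hasCycleᵇ-impossible : ∀ G → ¬ T (hasCycleᵇ G H)
  hasCycleᵇ-impossible G h =
    let k , someCycle = satisfied (any⁻ (λ k → any (cycleᵇ H) (seqs k (vertices G)))
                                        (upTo (suc (length (vertices G)))) h)
        c , isCycle   = satisfied (any⁻ (cycleᵇ H) (seqs k (vertices G)) someCycle)
    in  cycleᵇ-impossible c isCycle

  isVSFᵇ≡all-incident : ∀ G → isVSFᵇ G H ≡ all (incidentᵇ H) (vertices G)
  isVSFᵇ≡all-incident G rewrite ¬T⇒≡false (hasCycleᵇ-impossible G) = ∧-identityʳ _

-- Signed covers and their deletion recursion

touches : Edge → Vtx → Bool
touches e v = (Edge.end₁ e ≡ᵛ v) ∨ (Edge.end₂ e ≡ᵛ v)

avoids? : ∀ e v → Dec (¬ T (touches e v))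
avoids? e v = ¬? (T? (touches e v))

uncoveredBy : Edge → List Vtx → List Vtx
uncoveredBy e = filter (avoids? e)

sumℤ : List ℤ → ℤ
sumℤ = foldr ℤ._+_ (+ 0)

signedCovers : List Vtx → List Edge → ℤ
signedCovers V E = sumℤ (map (λ H → if all (incidentᵇ H) V then sgn (length H) else + 0) (subsets E))

-- An H ⊆ e ∷ E covering V either omits e, or contains e and then only has to cover
-- uncoveredBy e V with H ∖ e, with the opposite sign.
coverSum : List Vtx → List Edge → ℤ
coverSum V       (e ∷ E) = coverSum V E - coverSum (uncoveredBy e V) E
coverSum []      []      = + 1
coverSum (_ ∷ _) []      = + 0

sumℤ-++ : ∀ xs ys → sumℤ (xs ++ ys) ≡ sumℤ xs ℤ.+ sumℤ ys
sumℤ-++ []       ys = sym (ℤP.+-identityˡ _)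
sumℤ-++ (x ∷ xs) ys = trans (cong (ℤ._+_ x) (sumℤ-++ xs ys)) (sym (ℤP.+-assoc x _ _))

sumℤ-neg : ∀ xs → sumℤ (map -_ xs) ≡ - sumℤ xs
sumℤ-neg []       = refl
sumℤ-neg (x ∷ xs) = trans (cong (ℤ._+_ (- x)) (sumℤ-neg xs)) (sym (ℤP.neg-distrib-+ x _))

all-incident-∷ : ∀ e H V → all (incidentᵇ (e ∷ H)) V ≡ all (incidentᵇ H) (uncoveredBy e V)
all-incident-∷ e H []      = refl
all-incident-∷ e H (v ∷ V) with touches e v
... | true  = all-incident-∷ e H V
... | false = cong (incidentᵇ H v ∧_) (all-incident-∷ e H V)

signedCovers≡coverSum : ∀ V E → signedCovers V E ≡ coverSum V E
signedCovers≡coverSum []      []      = refl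
signedCovers≡coverSum (_ ∷ _) []      = refl
signedCovers≡coverSum V       (e ∷ E) = begin
  sumℤ (map covered (subsets E ++ map (e ∷_) (subsets E)))
    ≡⟨ cong sumℤ (map-++ covered (subsets E) _) ⟩
  sumℤ (map covered (subsets E) ++ map covered (map (e ∷_) (subsets E)))
    ≡⟨ sumℤ-++ (map covered (subsets E)) _ ⟩
  signedCovers V E ℤ.+ sumℤ (map covered (map (e ∷_) (subsets E)))
    ≡⟨ cong (λ xs → signedCovers V E ℤ.+ sumℤ xs) moved ⟩
  signedCovers V E ℤ.+ sumℤ (map -_ (map covered′ (subsets E)))
    ≡⟨ cong (ℤ._+_ (signedCovers V E)) (sumℤ-neg (map covered′ (subsets E))) ⟩
  signedCovers V E - signedCovers V′ E
    ≡⟨ cong₂ _-_ (signedCovers≡coverSum V E) (signedCovers≡coverSum V′ E) ⟩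
  coverSum V E - coverSum V′ E ∎
  where
  open ≡-Reasoning
  V′ : List Vtx
  V′ = uncoveredBy e V
  covered covered′ : List Edge → ℤ
  covered  H = if all (incidentᵇ H) V  then sgn (length H) else + 0
  covered′ H = if all (incidentᵇ H) V′ then sgn (length H) else + 0
  with-e : ∀ H → covered (e ∷ H) ≡ - covered′ H
  with-e H rewrite all-incident-∷ e H V with all (incidentᵇ H) V′
  ... | true  = ℤP.-1*i≡-i (sgn (length H))
  ... | false = refl
  moved : map covered (map (e ∷_) (subsets E)) ≡ map -_ (map covered′ (subsets E))
  moved = trans (sym (map-∘ (subsets E))) (trans (map-cong with-e (subsets E)) (map-∘ (subsets E)))

All-subsets : ∀ {A : Set} {P : A → Set} {xs} → All P xs → All (All P) (subsets xs)
All-subsets []       = [] ∷ []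
All-subsets (p ∷ ps) = ++⁺ (All-subsets ps) (map⁺ (All.map (p ∷_) (All-subsets ps)))

signature≡coverSum : ∀ G → All StepEdge (edges G) → signature G ≡ coverSum (vertices G) (edges G)
signature≡coverSum G steps =
  trans (cong sumℤ (map-cong-local (All.map vsf≡cover (All-subsets steps))))
        (signedCovers≡coverSum (vertices G) (edges G))
  where
  vsf≡cover : ∀ {H} → All StepEdge H → (if isVSFᵇ G H then sgn (length H) else + 0)
                                      ≡ (if all (incidentᵇ H) (vertices G) then sgn (length H) else + 0)
  vsf≡cover {H} s = cong (λ b → if b then sgn (length H) else + 0) (isVSFᵇ≡all-incident s G)

coverSum-↭ᵛ : ∀ {V W} E → V ↭ W → coverSum V E ≡ coverSum W E
coverSum-↭ᵛ               (e ∷ E) V↭W = cong₂ _-_ (coverSum-↭ᵛ E V↭W) (coverSum-↭ᵛ E (filter-↭ _ V↭W))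
coverSum-↭ᵛ {[]}    {[]}    [] _   = refl
coverSum-↭ᵛ {_ ∷ _} {_ ∷ _} [] _   = refl
coverSum-↭ᵛ {[]}    {_ ∷ _} [] V↭W = ⊥-elim (¬x∷xs↭[] (↭-sym V↭W))
coverSum-↭ᵛ {_ ∷ _} {[]}    [] V↭W = ⊥-elim (¬x∷xs↭[] V↭W)

uncoveredBy-comm : ∀ e f V → uncoveredBy e (uncoveredBy f V) ≡ uncoveredBy f (uncoveredBy e V)
uncoveredBy-comm e f []      = refl
uncoveredBy-comm e f (v ∷ V) with touches e v in te | touches f v in tf
... | true  | true  = uncoveredBy-comm e f V
... | true  | false rewrite te = uncoveredBy-comm e f V
... | false | true  rewrite tf = uncoveredBy-comm e f V
... | false | false rewrite te | tf = cong (v ∷_) (uncoveredBy-comm e f V)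

coverSum-↭ᵉ : ∀ {E F} → E ↭ F → ∀ V → coverSum V E ≡ coverSum V F
coverSum-↭ᵉ ↭.refl         V = refl
coverSum-↭ᵉ (↭.prep e E↭F) V = cong₂ _-_ (coverSum-↭ᵉ E↭F V) (coverSum-↭ᵉ E↭F (uncoveredBy e V))
coverSum-↭ᵉ (↭.trans E↭F F↭G) V = trans (coverSum-↭ᵉ E↭F V) (coverSum-↭ᵉ F↭G V)
coverSum-↭ᵉ {e ∷ f ∷ E} {_ ∷ _ ∷ F} (↭.swap e f E↭F) V = begin
  (c V E - c Vf E) - (c Ve E - c (uncoveredBy f Ve) E)
    ≡⟨ exchange (c V E) (c Vf E) (c Ve E) (c (uncoveredBy f Ve) E) ⟩
  (c V E - c Ve E) - (c Vf E - c (uncoveredBy f Ve) E)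
    ≡⟨ cong (λ W → (c V E - c Ve E) - (c Vf E - c W E)) (uncoveredBy-comm f e V) ⟩
  (c V E - c Ve E) - (c Vf E - c (uncoveredBy e Vf) E)
    ≡⟨ cong₂ _-_ (cong₂ _-_ (IH V) (IH Ve)) (cong₂ _-_ (IH Vf) (IH (uncoveredBy e Vf))) ⟩
  (c V F - c Ve F) - (c Vf F - c (uncoveredBy e Vf) F) ∎
  where
  open ≡-Reasoning
  c : List Vtx → List Edge → ℤ
  c = coverSum
  Ve Vf : List Vtx
  Ve = uncoveredBy e V
  Vf = uncoveredBy f V
  IH : ∀ V → coverSum V E ≡ coverSum V F
  IH = coverSum-↭ᵉ E↭F
  exchange : ∀ a b c d → (a - b) - (c - d) ≡ (a - c) - (b - d)
  exchange = solve-∀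

coverSum-uncoverable : ∀ {v V} E → v ∈ V → All (λ e → ¬ T (touches e v)) E → coverSum V E ≡ + 0
coverSum-uncoverable (e ∷ E) v∈V (¬te ∷ ¬tE) =
  cong₂ _-_ (coverSum-uncoverable E v∈V ¬tE) (coverSum-uncoverable E (∈-filter⁺ (avoids? e) v∈V ¬te) ¬tE)
coverSum-uncoverable {V = _ ∷ _} [] _ [] = refl

uncoveredBy-end₁ : ∀ e V → uncoveredBy e (Edge.end₁ e ∷ V) ≡ uncoveredBy e V
uncoveredBy-end₁ e V =
  filter-reject (avoids? e) (λ ¬t → ¬t (Equivalence.from T-∨ (inj₁ (≡ᵛ-refl (Edge.end₁ e)))))

uncoveredBy-end₂ : ∀ e V → uncoveredBy e (Edge.end₂ e ∷ V) ≡ uncoveredBy e V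
uncoveredBy-end₂ e V =
  filter-reject (avoids? e) (λ ¬t → ¬t (Equivalence.from T-∨ (inj₂ (≡ᵛ-refl (Edge.end₂ e)))))

value : Vtx → ℕ
value (base v)  = v
value (prime v) = v

touches-value : ∀ e v → T (touches e v) → value (Edge.end₁ e) ≡ value v ⊎ value (Edge.end₂ e) ≡ value v
touches-value e v t with ∨-split {Edge.end₁ e ≡ᵛ v} t
... | inj₁ t₁ = inj₁ (cong value (≡ᵛ⇒≡ {Edge.end₁ e} t₁))
... | inj₂ t₂ = inj₂ (cong value (≡ᵛ⇒≡ {Edge.end₂ e} t₂))

untouched : ∀ {e v} → value (Edge.end₁ e) ≢ value v → value (Edge.end₂ e) ≢ value v → ¬ T (touches e v)
untouched {e} {v} ≢₁ ≢₂ t = [ ≢₁ , ≢₂ ]′ (touches-value e v t)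

uncoveredBy-above : ∀ {d} e V → value (Edge.end₁ e) ≤ d → value (Edge.end₂ e) ≤ d
                  → All (λ v → d < value v) V → uncoveredBy e V ≡ V
uncoveredBy-above e V ₁≤d ₂≤d above =
  filter-all (avoids? e) (All.map below above)
  where
  below : ∀ {v} → _ < value v → ¬ T (touches e v)
  below {v} d<v = untouched {e} {v} (<⇒≢ (≤-<-trans ₁≤d d<v)) (<⇒≢ (≤-<-trans ₂≤d d<v))

-- Sweeping the values of μ₁ in increasing order

hang bridge : ℕ → Edge
hang   d = base d — prime d
bridge d = base d — base (suc d)

negateIf : Bool → ℤ → ℤ
negateIf true  x = - x
negateIf false x = x

baseUnless : Bool → ℕ → List Vtx
baseUnless true  _ = []
baseUnless false d = base d ∷ []

-- free / pinned: the value of the rest when base (d + 1) is uncovered / covered.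
bridgeValue : (covered bridge : Bool) (free pinned : ℤ) → ℤ
bridgeValue true  true  free pinned = free - pinned
bridgeValue false true  free pinned = - pinned
bridgeValue true  false free pinned = free
bridgeValue false false free pinned = + 0

suc∈⇒head≡suc : ∀ {d D} → All (d <_) D → AllPairs _<_ D → T (memᵇ (suc d) D)
              → ∃ λ D′ → D ≡ suc d ∷ D′ × All (suc d <_) D′
suc∈⇒head≡suc {d} {y ∷ D′} (d<y ∷ _) (y<D′ ∷ _) m with memᵇ⇒∈ {suc d} (y ∷ D′) m
... | here refl   = D′ , refl , y<D′
... | there sd∈D′ = ⊥-elim (<-irrefl refl (<-≤-trans d<y (≤-pred (All.lookup y<D′ sd∈D′))))

module Sweep (marked : ℕ → Bool) where

  primes : ℕ → List Vtx
  primes d = if marked d then prime d ∷ [] else []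

  hangings : ℕ → List Edge
  hangings d = if marked d then hang d ∷ [] else []

  bridges : ℕ → List ℕ → List Edge
  bridges d D = if memᵇ (suc d) D then bridge d ∷ [] else []

  sweepVertices : (covered : Bool) → List ℕ → List Vtx
  sweepVertices _       []      = []
  sweepVertices covered (d ∷ D) = baseUnless covered d ++ primes d ++ sweepVertices false D

  sweepEdges : List ℕ → List Edge
  sweepEdges []      = []
  sweepEdges (d ∷ D) = hangings d ++ bridges d D ++ sweepEdges D

  -- The hanging edge at a marked d is the only edge at prime d: it is forced, flips the
  -- sign and covers base d.
  transfer : List ℕ → (covered : Bool) → ℤ
  transfer []      _       = + 1
  transfer (d ∷ D) covered =
    negateIf (marked d) (bridgeValue (covered ∨ marked d) (memᵇ (suc d) D) (transfer D false) (transfer D true))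

  sweepVertices-above : ∀ {d} c D → All (d <_) D → All (λ v → d < value v) (sweepVertices c D)
  sweepVertices-above c []      []           = []
  sweepVertices-above c (x ∷ D) (d<x ∷ d<D) =
    ++⁺ (base-above c) (++⁺ primes-above (sweepVertices-above false D d<D))
    where
    base-above : ∀ c → All (λ v → _ < value v) (baseUnless c x)
    base-above true  = []
    base-above false = d<x ∷ []
    primes-above : All (λ v → _ < value v) (primes x)
    primes-above with marked x
    ... | true  = d<x ∷ []
    ... | false = []

  sweepEdges-avoid : ∀ {d v} D → All (d <_) D → value v ≤ d → All (λ e → ¬ T (touches e v)) (sweepEdges D)
  sweepEdges-avoid         []      []           _   = []
  sweepEdges-avoid {d} {v} (x ∷ D) (d<x ∷ d<D) v≤d =
    ++⁺ hangings-avoid (++⁺ bridges-avoid (sweepEdges-avoid D d<D v≤d))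
    where
    v<x : value v < x
    v<x = ≤-<-trans v≤d d<x
    hangings-avoid : All (λ e → ¬ T (touches e v)) (hangings x)
    hangings-avoid with marked x
    ... | true  = untouched {hang x} {v} (>⇒≢ v<x) (>⇒≢ v<x) ∷ []
    ... | false = []
    bridges-avoid : All (λ e → ¬ T (touches e v)) (bridges x D)
    bridges-avoid with memᵇ (suc x) D
    ... | true  = untouched {bridge x} {v} (>⇒≢ v<x) (>⇒≢ (<-trans v<x (n<1+n x))) ∷ []
    ... | false = []

  hangingStep : ∀ c {d} D → All (d <_) D →
    coverSum (sweepVertices c (d ∷ D)) (sweepEdges (d ∷ D))
    ≡ negateIf (marked d) (coverSum (baseUnless (c ∨ marked d) d ++ sweepVertices false D) (bridges d D ++ sweepEdges D))
  hangingStep c {d} D d<D with marked d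
  ... | false rewrite ∨-identityʳ c = refl
  ... | true  rewrite ∨-zeroʳ c = begin
    coverSum (baseUnless c d ++ prime d ∷ V) E - coverSum (uncoveredBy (hang d) (baseUnless c d ++ prime d ∷ V)) E
      ≡⟨ cong₂ _-_ (coverSum-uncoverable E (∈-++⁺ʳ (baseUnless c d) (here refl)) prime-avoided)
                   (cong (λ W → coverSum W E) (hang-removes c)) ⟩
    + 0 - coverSum V E
      ≡⟨ ℤP.+-identityˡ _ ⟩
    - coverSum V E ∎
    where
    open ≡-Reasoning
    V : List Vtx
    V = sweepVertices false D
    E : List Edge
    E = bridges d D ++ sweepEdges D
    prime-avoided : All (λ e → ¬ T (touches e (prime d))) E
    prime-avoided = ++⁺ bridges-avoid (sweepEdges-avoid D d<D ≤-refl)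
      where
      bridges-avoid : All (λ e → ¬ T (touches e (prime d))) (bridges d D)
      bridges-avoid with memᵇ (suc d) D
      ... | true  = (λ ()) ∷ []
      ... | false = []
    hang-removes : ∀ c → uncoveredBy (hang d) (baseUnless c d ++ prime d ∷ V) ≡ V
    hang-removes true  = trans (uncoveredBy-end₂ (hang d) V)
                               (uncoveredBy-above (hang d) V ≤-refl ≤-refl (sweepVertices-above false D d<D))
    hang-removes false = trans (uncoveredBy-end₁ (hang d) (prime d ∷ V))
                               (hang-removes true)

  bridge-removes : ∀ c d D → All (suc d <_) D →
    uncoveredBy (bridge d) (baseUnless c d ++ sweepVertices false (suc d ∷ D)) ≡ sweepVertices true (suc d ∷ D)
  bridge-removes false d D above = trans (uncoveredBy-end₁ (bridge d) _) (bridge-removes true d D above)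
  bridge-removes true  d D above = trans (uncoveredBy-end₂ (bridge d) _) primes-kept
    where
    V : List Vtx
    V = sweepVertices false D
    rest-kept : uncoveredBy (bridge d) V ≡ V
    rest-kept = uncoveredBy-above (bridge d) V (n≤1+n d) ≤-refl (sweepVertices-above false D above)
    primes-kept : uncoveredBy (bridge d) (primes (suc d) ++ V) ≡ primes (suc d) ++ V
    primes-kept with marked (suc d)
    ... | true  = cong (prime (suc d) ∷_) rest-kept
    ... | false = rest-kept

  bridgeStep : ∀ c {d} D → All (d <_) D → AllPairs _<_ D →
    coverSum (baseUnless c d ++ sweepVertices false D) (bridges d D ++ sweepEdges D)
    ≡ bridgeValue c (memᵇ (suc d) D) (coverSum (sweepVertices false D) (sweepEdges D))
                                     (coverSum (sweepVertices true D) (sweepEdges D))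
  bridgeStep c {d} D d<D sorted with memᵇ (suc d) D in has-bridge
  bridgeStep true  D d<D _ | false = refl
  bridgeStep false D d<D _ | false = coverSum-uncoverable _ (here refl) (sweepEdges-avoid D d<D ≤-refl)
  bridgeStep c {d} D d<D sorted | true with suc∈⇒head≡suc d<D sorted (subst T (sym has-bridge) _)
  ... | D′ , refl , above = used c
    where
    W : List Vtx
    W = sweepVertices false (suc d ∷ D′)
    E : List Edge
    E = sweepEdges (suc d ∷ D′)
    used : ∀ c → coverSum (baseUnless c d ++ W) (bridge d ∷ E)
               ≡ bridgeValue c true (coverSum W E) (coverSum (sweepVertices true (suc d ∷ D′)) E)
    used true  = cong (λ X → coverSum W E - coverSum X E) (bridge-removes true d D′ above)
    used false = trans (cong₂ _-_ (coverSum-uncoverable E (here refl) (sweepEdges-avoid (suc d ∷ D′) d<D ≤-refl))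
                                  (cong (λ X → coverSum X E) (bridge-removes false d D′ above)))
                       (ℤP.+-identityˡ _)

  coverSum≡transfer : ∀ c D → AllPairs _<_ D → coverSum (sweepVertices c D) (sweepEdges D) ≡ transfer D c
  coverSum≡transfer true  []      _                = refl
  coverSum≡transfer false []      _                = refl
  coverSum≡transfer c     (d ∷ D) (d<D ∷ sorted) = begin
    coverSum (sweepVertices c (d ∷ D)) (sweepEdges (d ∷ D))
      ≡⟨ hangingStep c D d<D ⟩
    negateIf (marked d) (coverSum (baseUnless c′ d ++ sweepVertices false D) (bridges d D ++ sweepEdges D))
      ≡⟨ cong (negateIf (marked d)) (bridgeStep c′ D d<D sorted) ⟩
    negateIf (marked d) (bridgeValue c′ (memᵇ (suc d) D) (coverSum (sweepVertices false D) (sweepEdges D))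
                                                          (coverSum (sweepVertices true D) (sweepEdges D)))
      ≡⟨ cong₂ (λ free pinned → negateIf (marked d) (bridgeValue c′ (memᵇ (suc d) D) free pinned))
               (coverSum≡transfer false D sorted) (coverSum≡transfer true D sorted) ⟩
    transfer (d ∷ D) c ∎
    where
    open ≡-Reasoning
    c′ : Bool
    c′ = c ∨ marked d

  marks : List ℕ → List ℕ
  marks = filter (λ v → T? (marked v))

  backbone : List ℕ → List Edge
  backbone D = map bridge (filter (λ v → T? (memᵇ (suc v) D)) D)

  map-prime-marks : ∀ d D → map prime (marks (d ∷ D)) ≡ primes d ++ map prime (marks D)
  map-prime-marks d D with marked d
  ... | true  = refl
  ... | false = refl

  map-hang-marks : ∀ d D → map hang (marks (d ∷ D)) ≡ hangings d ++ map hang (marks D)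
  map-hang-marks d D with marked d
  ... | true  = refl
  ... | false = refl

  backbone-∷ : ∀ {d D} → All (d <_) D → backbone (d ∷ D) ≡ bridges d D ++ backbone D
  backbone-∷ {d} {D} d<D =
    trans (cong (map bridge) (filter-cong-local (λ v → T? (memᵇ (suc v) (d ∷ D))) (λ v → T? (memᵇ (suc v) D))
                                                (All.map bridge-unchanged (≤-refl ∷ All.map <⇒≤ d<D))))
          split
    where
    bridge-unchanged : ∀ {v} → d ≤ v → T (memᵇ (suc v) (d ∷ D)) ⇔ T (memᵇ (suc v) D)
    bridge-unchanged d≤v = memᵇ-∷-≢ D (>⇒≢ (s≤s d≤v))
    split : map bridge (filter (λ v → T? (memᵇ (suc v) D)) (d ∷ D)) ≡ bridges d D ++ backbone D
    split with memᵇ (suc d) D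
    ... | true  = refl
    ... | false = refl

  sweepVertices-↭ : ∀ D → map base D ++ map prime (marks D) ↭ sweepVertices false D
  sweepVertices-↭ []      = ↭.refl
  sweepVertices-↭ (d ∷ D) rewrite map-prime-marks d D = ↭.prep (base d) (begin
    map base D ++ primes d ++ map prime (marks D)  ↭⟨ shifts (map base D) (primes d) ⟩
    primes d ++ map base D ++ map prime (marks D)  ↭⟨ ++⁺ˡ (primes d) (sweepVertices-↭ D) ⟩
    primes d ++ sweepVertices false D              ∎)
    where open PermutationReasoning

  sweepEdges-↭ : ∀ D → AllPairs _<_ D → sweepEdges D ↭ backbone D ++ map hang (marks D)
  sweepEdges-↭ []      _                = ↭.refl
  sweepEdges-↭ (d ∷ D) (d<D ∷ sorted) rewrite backbone-∷ d<D | map-hang-marks d D = begin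
    hangings d ++ bridges d D ++ sweepEdges D
      ↭⟨ ++⁺ˡ (hangings d) (++⁺ˡ (bridges d D) (sweepEdges-↭ D sorted)) ⟩
    hangings d ++ bridges d D ++ backbone D ++ hanged
      ↭⟨ shifts (hangings d) (bridges d D) ⟩
    bridges d D ++ hangings d ++ backbone D ++ hanged
      ↭⟨ ++⁺ˡ (bridges d D) (shifts (hangings d) (backbone D)) ⟩
    bridges d D ++ backbone D ++ hangings d ++ hanged
      ↭⟨ ↭-++-assoc (bridges d D) (backbone D) _ ⟨
    (bridges d D ++ backbone D) ++ hangings d ++ hanged ∎
    where
    open PermutationReasoning
    hanged : List Edge
    hanged = map hang (marks D)

  signature≡transfer : ∀ D → AllPairs _<_ D →
    signature (graph (map base D ++ map prime (marks D)) (backbone D ++ map hang (marks D))) ≡ transfer D false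
  signature≡transfer D sorted = begin
    signature (graph V E)                           ≡⟨ signature≡coverSum (graph V E) steps ⟩
    coverSum V E                                    ≡⟨ coverSum-↭ᵉ (↭-sym (sweepEdges-↭ D sorted)) V ⟩
    coverSum V (sweepEdges D)                       ≡⟨ coverSum-↭ᵛ (sweepEdges D) (sweepVertices-↭ D) ⟩
    coverSum (sweepVertices false D) (sweepEdges D) ≡⟨ coverSum≡transfer false D sorted ⟩
    transfer D false                                ∎
    where
    open ≡-Reasoning
    V : List Vtx
    V = map base D ++ map prime (marks D)
    E : List Edge
    E = backbone D ++ map hang (marks D)
    steps : All StepEdge E
    steps = ++⁺ (map⁺ (All.universal (λ _ → step ↗base) (filter (λ v → T? (memᵇ (suc v) D)) D)))
                (map⁺ (All.universal (λ _ → step ↗prime) (marks D)))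

-- χ x is the signature of a path with x edges.
χ : ℕ → ℤ
χ 0                   = + 0
χ 1                   = - + 1
χ 2                   = + 1
χ (suc (suc (suc x))) = χ x

χ-rec : ∀ m → χ m ℤ.+ χ (suc m) ≡ - χ (suc (suc m))
χ-rec 0                   = refl
χ-rec 1                   = refl
χ-rec 2                   = refl
χ-rec (suc (suc (suc m))) = χ-rec m

χprod : List ℕ → ℤ
χprod = foldr (λ x p → χ x ℤ.* p) (+ 1)

χprod-++ : ∀ xs ys → χprod (xs ++ ys) ≡ χprod xs ℤ.* χprod ys
χprod-++ []       ys = sym (ℤP.*-identityˡ _)
χprod-++ (x ∷ xs) ys = trans (cong (χ x ℤ.*_) (χprod-++ xs ys)) (sym (ℤP.*-assoc (χ x) _ _))

sgn-+ : ∀ m n → sgn (m + n) ≡ sgn m ℤ.* sgn n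
sgn-+ = ℤP.^-distribˡ-+-* (- + 1)

-- The factor contributed to χprod (SIG) · (-1)^|μ₂| by a run d … n with marked values as,
-- followed by runs contributing X.
runFactor : (d n : ℕ) → List ℕ → ℤ → ℤ
runFactor d n as X = χprod (sigRun d n as) ℤ.* (sgn (length as) ℤ.* X)

-- sigRun d n as = lead d n as ∷ trailing n as, and only the lead depends on d.
lead : ℕ → ℕ → List ℕ → ℕ
lead d n []      = n ∸ d
lead d n (a ∷ _) = a ∸ d + 1

trailing : ℕ → List ℕ → List ℕ
trailing n []       = []
trailing n (a ∷ as) = gaps a as n

runRest : ℕ → List ℕ → ℤ → ℤ
runRest n as X = χprod (trailing n as) ℤ.* (sgn (length as) ℤ.* X)

runFactor-lead : ∀ d n as X → runFactor d n as X ≡ χ (lead d n as) ℤ.* runRest n as X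
runFactor-lead d n []       X = ℤP.*-assoc (χ (n ∸ d)) (+ 1) (+ 1 ℤ.* X)
runFactor-lead d n (a ∷ as) X = ℤP.*-assoc (χ (a ∸ d + 1)) (χprod (gaps a as n)) _

gaps-lead : ∀ d n as → gaps d as n ≡ suc (lead d n as) ∷ trailing n as
gaps-lead d n []       = cong (_∷ []) (+-comm (n ∸ d) 1)
gaps-lead d n (a ∷ as) = cong (_∷ gaps a as n) (+-suc (a ∸ d) 1)

runFactor-marked : ∀ d n as X → runFactor d n (d ∷ as) X ≡ χ (suc (lead d n as)) ℤ.* runRest n as X
runFactor-marked d n as X rewrite n∸n≡0 d | gaps-lead d n as =
  signs (χ (suc (lead d n as))) (χprod (trailing n as)) (sgn (length as)) X
  where
  signs : ∀ c p s x → (- + 1 ℤ.* (c ℤ.* p)) ℤ.* (- + 1 ℤ.* s ℤ.* x) ≡ c ℤ.* (p ℤ.* (s ℤ.* x))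
  signs = solve-∀

runFactor-doubled : ∀ d n as X → runFactor d n (d ∷ d ∷ as) X ≡ - runFactor d n (d ∷ as) X
runFactor-doubled d n as X rewrite n∸n≡0 d = signs (χprod (gaps d as n)) (sgn (length as)) X
  where
  signs : ∀ g s x → (- + 1 ℤ.* (+ 1 ℤ.* g)) ℤ.* (- + 1 ℤ.* (- + 1 ℤ.* s) ℤ.* x)
                  ≡ - ((- + 1 ℤ.* g) ℤ.* (- + 1 ℤ.* s ℤ.* x))
  signs = solve-∀

∸-suc : ∀ {d n} → suc d ≤ n → n ∸ d ≡ suc (n ∸ suc d)
∸-suc {zero}  {suc n} _         = refl
∸-suc {suc d} {suc n} (s≤s d<n) = ∸-suc d<n

lead-suc : ∀ {d n} as → suc d ≤ n → All (suc d ≤_) as → lead d n as ≡ suc (lead (suc d) n as)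
lead-suc []      d<n _         = ∸-suc d<n
lead-suc (_ ∷ _) _   (d<a ∷ _) = cong (_+ 1) (∸-suc d<a)

runFactor-shift : ∀ {d n} as X → suc d ≤ n → All (suc d ≤_) as
                → runFactor (suc d) n (suc d ∷ as) X ≡ runFactor d n as X
runFactor-shift {d} {n} as X d<n d<as = begin
  runFactor (suc d) n (suc d ∷ as) X       ≡⟨ runFactor-marked (suc d) n as X ⟩
  χ (suc (lead (suc d) n as)) ℤ.* runRest n as X ≡⟨ cong (λ l → χ l ℤ.* runRest n as X) (lead-suc as d<n d<as) ⟨
  χ (lead d n as) ℤ.* runRest n as X      ≡⟨ runFactor-lead d n as X ⟨
  runFactor d n as X                       ∎
  where open ≡-Reasoning

runFactor-split : ∀ {d n} as X → suc d ≤ n → All (suc d ≤_) as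
                → runFactor (suc d) n as X ℤ.+ runFactor (suc d) n (suc d ∷ as) X ≡ - runFactor d n (d ∷ as) X
runFactor-split {d} {n} as X d<n d<as = begin
  runFactor (suc d) n as X ℤ.+ runFactor (suc d) n (suc d ∷ as) X
    ≡⟨ cong₂ ℤ._+_ (runFactor-lead (suc d) n as X) (runFactor-marked (suc d) n as X) ⟩
  χ m ℤ.* R ℤ.+ χ (suc m) ℤ.* R    ≡⟨ ℤP.*-distribʳ-+ R (χ m) (χ (suc m)) ⟨
  (χ m ℤ.+ χ (suc m)) ℤ.* R        ≡⟨ cong (ℤ._* R) (χ-rec m) ⟩
  - χ (suc (suc m)) ℤ.* R           ≡⟨ ℤP.neg-distribˡ-* (χ (suc (suc m))) R ⟨
  - (χ (suc (suc m)) ℤ.* R)         ≡⟨ cong (λ l → - (χ (suc l) ℤ.* R)) (lead-suc as d<n d<as) ⟨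
  - (χ (suc (lead d n as)) ℤ.* R)   ≡⟨ cong -_ (runFactor-marked d n as X) ⟨
  - runFactor d n (d ∷ as) X        ∎
  where
  open ≡-Reasoning
  m : ℕ
  m = lead (suc d) n as
  R : ℤ
  R = runRest n as X

runFactor-singleton : ∀ d X → runFactor d d [] X ≡ + 0
runFactor-singleton d X rewrite n∸n≡0 d = ℤP.*-zeroˡ (+ 1 ℤ.* X)

runFactor-marked-singleton : ∀ d X → runFactor d d (d ∷ []) X ≡ - X
runFactor-marked-singleton d X rewrite n∸n≡0 d = trans (ℤP.*-identityˡ _) (ℤP.-1*i≡-i X)

lastOf : ℕ → List ℕ → ℕ
lastOf d []       = d
lastOf _ (x ∷ xs) = lastOf x xs

-- SIGcomp finds the end of a run with a function local to its where block. With no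
-- marked values and first entry 0, the only entry it produces is that end.
SIGcomp-unmarked : ∀ d xs → SIGcomp [] (0 ∷ d ∷ xs) ≡ lastOf d xs ∷ []
SIGcomp-unmarked d []       = refl
SIGcomp-unmarked d (y ∷ ys) = SIGcomp-unmarked y ys

lastOf-∈ : ∀ d ρ → lastOf d ρ ∈ d ∷ ρ
lastOf-∈ d []       = here refl
lastOf-∈ d (x ∷ xs) = there (lastOf-∈ x xs)

addTo-merge : ∀ d ρ rs → addTo d ((suc d ∷ ρ) ∷ rs) ≡ (d ∷ suc d ∷ ρ) ∷ rs
addTo-merge d ρ rs rewrite Equivalence.to T-≡ (≡⇒≡ᵇ d d refl) = refl

addTo-split : ∀ {d y} ρ rs → y ≢ suc d → addTo d ((y ∷ ρ) ∷ rs) ≡ (d ∷ []) ∷ (y ∷ ρ) ∷ rs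
addTo-split ρ rs y≢sd rewrite ¬T⇒≡false (y≢sd ∘ ≡ᵇ⇒≡ _ _) = refl

concat-addTo : ∀ x rs → concat (addTo x rs) ≡ x ∷ concat rs
concat-addTo x []             = refl
concat-addTo x ([] ∷ rs)      = refl
concat-addTo x ((y ∷ r) ∷ rs) with y ≡ᵇ suc x
... | true  = refl
... | false = refl

concat-runs : ∀ D → concat (runs D) ≡ D
concat-runs []      = refl
concat-runs (x ∷ D) = trans (concat-addTo x (runs D)) (cong (x ∷_) (concat-runs D))

module Runs (m2 : List ℕ) where

  open Sweep (λ v → memᵇ v m2)

  SIGcomp-∷ : ∀ k ρ → SIGcomp m2 (k ∷ ρ) ≡ sigRun k (lastOf k ρ) (marks (k ∷ ρ))
  SIGcomp-∷ k []       = refl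
  SIGcomp-∷ k (d ∷ xs)
    with filter (λ v → T? (memᵇ v [])) xs
       | filter-none (λ v → T? (memᵇ v [])) {xs} (All.universal (λ _ ()) xs)
       | SIGcomp-unmarked d xs
  ... | .[] | refl | end = cong (λ n → sigRun k n (marks (k ∷ d ∷ xs))) (∷-injectiveˡ end)

  runsValue : List (List ℕ) → ℤ
  runsValue rs = χprod (concatMap (SIGcomp m2) rs) ℤ.* sgn (length (marks (concat rs)))

  runsValue-∷ : ∀ d ρ rs → runsValue ((d ∷ ρ) ∷ rs) ≡ runFactor d (lastOf d ρ) (marks (d ∷ ρ)) (runsValue rs)
  runsValue-∷ d ρ rs
    rewrite χprod-++ (SIGcomp m2 (d ∷ ρ)) (concatMap (SIGcomp m2) rs)
          | filter-++ (λ v → T? (memᵇ v m2)) (d ∷ ρ) (concat rs)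
          | length-++ (marks (d ∷ ρ)) {marks (concat rs)}
          | sgn-+ (length (marks (d ∷ ρ))) (length (marks (concat rs)))
          | SIGcomp-∷ d ρ
    = regroup (χprod (sigRun d (lastOf d ρ) (marks (d ∷ ρ)))) (χprod (concatMap (SIGcomp m2) rs))
              (sgn (length (marks (d ∷ ρ)))) (sgn (length (marks (concat rs))))
    where
    regroup : ∀ a b c e → a ℤ.* b ℤ.* (c ℤ.* e) ≡ a ℤ.* (c ℤ.* (b ℤ.* e))
    regroup = solve-∀

  -- A base d that is already covered contributes like a marked d without the sign of
  -- its hanging edge.
  HeadRunValues : ℕ → List ℕ → ℕ → List ℕ → ℤ → Set
  HeadRunValues d D n as X = transfer (d ∷ D) false ≡ runFactor d n as X
                           × transfer (d ∷ D) true  ≡ - runFactor d n (d ∷ as) X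

  continueRun : ∀ {d D n X} ρ → suc d ≤ n → All (suc d ≤_) (marks (suc d ∷ ρ))
              → HeadRunValues (suc d) D n (marks (suc d ∷ ρ)) X
              → HeadRunValues d (suc d ∷ D) n (marks (d ∷ suc d ∷ ρ)) X
  continueRun {d} {D} {n} {X} ρ d<n d<as (free , pinned)
    rewrite memᵇ-head (suc d) D | free | pinned with memᵇ d m2
  ... | false = trans (ℤP.neg-involutive F₁) (runFactor-shift as X d<n d<as)
              , trans (cong (ℤ._+_ F₀) (ℤP.neg-involutive F₁)) (runFactor-split as X d<n d<as)
    where
    as : List ℕ
    as = marks (suc d ∷ ρ)
    F₀ F₁ : ℤ
    F₀ = runFactor (suc d) n as X
    F₁ = runFactor (suc d) n (suc d ∷ as) X
  ... | true  = marked-value , trans marked-value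
                    (sym (trans (cong -_ (runFactor-doubled d n as X)) (ℤP.neg-involutive _)))
    where
    as : List ℕ
    as = marks (suc d ∷ ρ)
    marked-value : - (runFactor (suc d) n as X - - runFactor (suc d) n (suc d ∷ as) X) ≡ runFactor d n (d ∷ as) X
    marked-value = trans (cong (λ x → - (runFactor (suc d) n as X ℤ.+ x)) (ℤP.neg-involutive _))
                         (trans (cong -_ (runFactor-split as X d<n d<as)) (ℤP.neg-involutive _))

  endRun : ∀ {d} D → memᵇ (suc d) D ≡ false → HeadRunValues d D d (marks (d ∷ [])) (transfer D false)
  endRun {d} D no-bridge rewrite no-bridge with memᵇ d m2
  ... | false = sym (runFactor-singleton d X)
              , sym (trans (cong -_ (runFactor-marked-singleton d X)) (ℤP.neg-involutive X))
    where
      X : ℤ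
      X = transfer D false
  ... | true  = sym (runFactor-marked-singleton d X)
              , sym (trans (cong -_ (runFactor-doubled d d [] X))
                           (trans (ℤP.neg-involutive _) (runFactor-marked-singleton d X)))
    where
      X : ℤ
      X = transfer D false

  record HeadRun (d : ℕ) (D : List ℕ) : Set where
    field
      rest   : List ℕ
      others : List (List ℕ)
      runs≡  : runs (d ∷ D) ≡ (d ∷ rest) ∷ others
      above  : All (d <_) rest
      values : HeadRunValues d D (lastOf d rest) (marks (d ∷ rest)) (runsValue others)

  headRun : ∀ d D → AllPairs _<_ (d ∷ D) → HeadRun d D
  headRun d []      _                        = record
    { rest = []; others = []; runs≡ = refl; above = []; values = endRun [] refl }
  headRun d (y ∷ D) ((d<y ∷ d<D) ∷ sorted) with y ≟ suc d
  ... | yes refl = record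
    { rest   = suc d ∷ rest
    ; others = others
    ; runs≡  = trans (cong (addTo d) runs≡) (addTo-merge d rest others)
    ; above  = n<1+n d ∷ All.map (<-trans (n<1+n d)) above
    ; values = continueRun {D = D} rest (All.lookup (≤-refl ∷ All.map <⇒≤ above) (lastOf-∈ (suc d) rest))
                           (filter⁺ (λ v → T? (memᵇ v m2)) (≤-refl ∷ All.map <⇒≤ above)) values
    }
    where open HeadRun (headRun (suc d) D sorted)
  ... | no y≢sd = record
    { rest   = []
    ; others = (y ∷ rest) ∷ others
    ; runs≡  = trans (cong (addTo d) runs≡) (addTo-split rest others y≢sd)
    ; above  = []
    ; values = subst (HeadRunValues d (y ∷ D) d (marks (d ∷ [])))
                     (trans (proj₁ values) (sym (runsValue-∷ y rest others)))
                     (endRun (y ∷ D) no-bridge)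
    }
    where
    open HeadRun (headRun y D sorted)
    no-bridge : memᵇ (suc d) (y ∷ D) ≡ false
    no-bridge = ¬T⇒≡false (λ m → y≢sd (∷-injectiveˡ (proj₁ (proj₂ (suc∈⇒head≡suc (d<y ∷ d<D) sorted m)))))

  transfer≡runsValue : ∀ D → AllPairs _<_ D → transfer D false ≡ runsValue (runs D)
  transfer≡runsValue []      _      = refl
  transfer≡runsValue (d ∷ D) sorted = begin
    transfer (d ∷ D) false                                        ≡⟨ proj₁ values ⟩
    runFactor d (lastOf d rest) (marks (d ∷ rest)) (runsValue others) ≡⟨ runsValue-∷ d rest others ⟨
    runsValue ((d ∷ rest) ∷ others)                               ≡⟨ cong runsValue runs≡ ⟨
    runsValue (runs (d ∷ D))                                      ∎
    where
    open ≡-Reasoning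
    open HeadRun (headRun d D sorted)

  signature≡χprod : ∀ D → AllPairs _<_ D →
    signature (graph (map base D ++ map prime (marks D)) (backbone D ++ map hang (marks D)))
    ≡ χprod (concatMap (SIGcomp m2) (runs D)) ℤ.* sgn (length (marks D))
  signature≡χprod D sorted = begin
    signature (graph (map base D ++ map prime (marks D)) (backbone D ++ map hang (marks D)))
      ≡⟨ signature≡transfer D sorted ⟩
    transfer D false
      ≡⟨ transfer≡runsValue D sorted ⟩
    runsValue (runs D)
      ≡⟨ cong (λ xs → χprod (concatMap (SIGcomp m2) (runs D)) ℤ.* sgn (length (marks xs))) (concat-runs D) ⟩
    χprod (concatMap (SIGcomp m2) (runs D)) ℤ.* sgn (length (marks D)) ∎
    where open ≡-Reasoning

-- Reading off the signature from the residues mod 3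

%3-period : ∀ x → suc (suc (suc x)) % 3 ≡ x % 3
%3-period x = trans (cong (_% 3) (+-comm 3 x)) ([m+n]%n≡m%n x 3)

χ-residue : ∀ x → (x % 3 ≡ 0 × χ x ≡ + 0) ⊎ (x % 3 ≡ 1 × χ x ≡ - + 1) ⊎ (x % 3 ≡ 2 × χ x ≡ + 1)
χ-residue 0                   = inj₁ (refl , refl)
χ-residue 1                   = inj₂ (inj₁ (refl , refl))
χ-residue 2                   = inj₂ (inj₂ (refl , refl))
χ-residue (suc (suc (suc x))) rewrite %3-period x = χ-residue x

χprod-zero : ∀ S → Any (λ x → x % 3 ≡ 0) S → χprod S ≡ + 0
χprod-zero (x ∷ S) (here x≡0) with χ-residue x
... | inj₁ (_ , χx≡0)          = trans (cong (ℤ._* χprod S) χx≡0) (ℤP.*-zeroˡ (χprod S))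
... | inj₂ (inj₁ (x≡1 , _))    = ⊥-elim (0≢1+n (trans (sym x≡0) x≡1))
... | inj₂ (inj₂ (x≡2 , _))    = ⊥-elim (0≢1+n (trans (sym x≡0) x≡2))
χprod-zero (x ∷ S) (there some) = trans (cong (χ x ℤ.*_) (χprod-zero S some)) (ℤP.*-zeroʳ (χ x))

χprod-sign : ∀ S → ¬ Any (λ x → x % 3 ≡ 0) S → χprod S ≡ sgn (count≡1mod3 S)
χprod-sign []      _    = refl
χprod-sign (x ∷ S) none with χ-residue x
... | inj₁ (x≡0 , _)         = ⊥-elim (none (here x≡0))
... | inj₂ (inj₁ (x≡1 , χx)) rewrite χx | x≡1 = cong (- + 1 ℤ.*_) (χprod-sign S (none ∘ there))
... | inj₂ (inj₂ (x≡2 , χx)) rewrite χx | x≡2 = trans (ℤP.*-identityˡ _) (χprod-sign S (none ∘ there))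

sgn≢0 : ∀ n → sgn n ≢ + 0
sgn≢0 zero    ()
sgn≢0 (suc n) eq = sgn≢0 n (ℤP.neg-injective (trans (sym (ℤP.-1*i≡-i (sgn n))) eq))

dedup-⊆ : ∀ xs {v} → v ∈ dedup xs → v ∈ xs
dedup-⊆ (x ∷ xs) v∈ with memᵇ x xs
... | true = there (dedup-⊆ xs v∈)
... | false with v∈
...   | here refl  = here refl
...   | there v∈′ = there (dedup-⊆ xs v∈′)

dedup-strict : ∀ xs → AllPairs _≤_ xs → AllPairs _<_ (dedup xs)
dedup-strict []       []               = []
dedup-strict (x ∷ xs) (x≤xs ∷ sorted) with memᵇ x xs in repeated
... | true  = dedup-strict xs sorted
... | false = All.tabulate above ∷ dedup-strict xs sorted
  where
  above : ∀ {v} → v ∈ dedup xs → x < v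
  above v∈ = ≤∧≢⇒< (All.lookup x≤xs (dedup-⊆ xs v∈)) λ { refl → subst T repeated (∈⇒memᵇ {x} (dedup-⊆ xs v∈)) }

filter-memᵇ-filter : ∀ {P : ℕ → Set} (P? : Decidable P) xs
                   → filter (λ v → T? (memᵇ v (filter P? xs))) xs ≡ filter P? xs
filter-memᵇ-filter {P} P? xs = filter-cong-local (λ v → T? (memᵇ v (filter P? xs))) P? {xs} (All.tabulate member⇔P)
  where
  member⇔P : ∀ {v} → v ∈ xs → T (memᵇ v (filter P? xs)) ⇔ P v
  member⇔P {v} v∈xs = mk⇔ (λ m → proj₂ (∈-filter⁻ P? {xs = xs} (memᵇ⇒∈ (filter P? xs) m)))
                            (λ p → ∈⇒memᵇ {v} (∈-filter⁺ P? v∈xs p))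

signature-Gλ : ∀ λs → Linked _≤_ λs → signature (Gλ λs) ≡ χprod (SIG λs) ℤ.* sgn (length (μ₂ λs))
signature-Gλ λs increasing =
  subst (λ ms → signature (graph (map base m1 ++ map prime ms) (Sweep.backbone marked m1 ++ map hang ms))
                ≡ χprod (SIG λs) ℤ.* sgn (length ms))
        (filter-memᵇ-filter (λ v → 2 ≤? occ v λs) m1)
        (Runs.signature≡χprod (μ₂ λs) m1 (dedup-strict λs (Linked⇒AllPairs ≤-trans increasing)))
  where
  m1 : List ℕ
  m1 = μ₁ λs
  marked : ℕ → Bool
  marked = λ v → memᵇ v (μ₂ λs)

theorem2p16 : (λs : List ℕ) → Neighborly λs →
    ((signature (Gλ λs) ≡ + 0) ⇔ Any (λ x → x % 3 ≡ 0) (SIG λs))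
    × (¬ Any (λ x → x % 3 ≡ 0) (SIG λs) →
        signature (Gλ λs) ≡ sgn (count≡1mod3 (SIG λs) + length (μ₂ λs)))
theorem2p16 λs ((_ , increasing) , _ , _) = mk⇔ vanishing⇒residue0 residue0⇒vanishing , no-residue0
  where
  S : List ℕ
  S = SIG λs
  s : ℕ
  s = length (μ₂ λs)
  signature≡ : signature (Gλ λs) ≡ χprod S ℤ.* sgn s
  signature≡ = signature-Gλ λs increasing
  no-residue0 : ¬ Any (λ x → x % 3 ≡ 0) S → signature (Gλ λs) ≡ sgn (count≡1mod3 S + s)
  no-residue0 none =
    trans signature≡ (trans (cong (ℤ._* sgn s) (χprod-sign S none)) (sym (sgn-+ (count≡1mod3 S) s)))
  residue0⇒vanishing : Any (λ x → x % 3 ≡ 0) S → signature (Gλ λs) ≡ + 0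
  residue0⇒vanishing some =
    trans signature≡ (trans (cong (ℤ._* sgn s) (χprod-zero S some)) (ℤP.*-zeroˡ (sgn s)))
  vanishing⇒residue0 : signature (Gλ λs) ≡ + 0 → Any (λ x → x % 3 ≡ 0) S
  vanishing⇒residue0 vanishes with Any.any? (λ x → x % 3 ≟ 0) S
  ... | yes some = some
  ... | no none  = ⊥-elim (sgn≢0 (count≡1mod3 S + s) (trans (sym (no-residue0 none)) vanishes))
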